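{- Let $G$ be a graph with more than one vertex, and write $q(G;x,y)=\sum_{i,j\ge 0}a_{ij}x^iy^j$. Then $a_{10}=-a_{01}$, i.e. the coefficient of $x^1y^0$ is the negative of the coefficient of $x^0y^1$.
   Context: Graphs are finite, without multiple edges, and may have loops; the adjacency matrix over $\mathbb{F}_2$ has a $1$ on the diagonal at looped vertices. The two-variable interlace polynomial is $q(G;x,y)=\sum_{S\subseteq V(G)}(x-1)^{r(G[S])}(y-1)^{n(G[S])}$, where $r(G[S])$ and $n(G[S])=|S|-r(G[S])$ are the $\mathbb{F}_2$-rank and nullity of the adjacency matrix of the induced subgraph $G[S]$ (the empty set contributing $1$). -}

module Defs where

open import Data.Bool using (Bool; true; false; _∧_; _∨_; not; _xor_; if_then_else_; T)
open import Data.Nat as ℕ using (ℕ; zero; suc; _⊔_; _∸_)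
open import Data.Integer as ℤ using (ℤ; +_)
open import Data.Fin using (Fin)
open import Data.List using (List; []; _∷_; map; foldr; filter; concatMap; allFin)
import Data.List as L
open import Data.Bool.ListAction using (all; any)
open import Data.Vec using (Vec; []; _∷_; lookup; count)
open import Relation.Binary.PropositionalEquality using (_≡_)

-- Graphs (finite, no multiple edges, loops allowed) on vertex set Fin n,
-- given by their symmetric adjacency matrix over F₂ = Bool (xor = +).
-- adj v v = true  iff  v carries a loop.

record Graph (n : ℕ) : Set where
  field
    adj : Fin n → Fin n → Bool
    sym : ∀ u v → adj u v ≡ adj v u
open Graph public

Subset : ℕ → Set
Subset n = Vec Bool n

allSubsets : (n : ℕ) → List (Subset n)
allSubsets zero    = [] ∷ []
allSubsets (suc n) = concatMap (λ s → (false ∷ s) ∷ (true ∷ s) ∷ []) (allSubsets n)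

_∈ₛ_ : ∀ {n} → Fin n → Subset n → Bool
i ∈ₛ S = lookup S i

∣_∣ₛ : ∀ {n} → Subset n → ℕ
∣ S ∣ₛ = count (λ b → Data.Bool._≟_ b true) S
  where import Data.Bool

allB : ∀ {n} → (Fin n → Bool) → Bool
allB {n} p = all p (allFin n)

anyB : ∀ {n} → (Fin n → Bool) → Bool
anyB {n} p = any p (allFin n)

_⊆ₛ_ : ∀ {n} → Subset n → Subset n → Bool
U ⊆ₛ T = allB (λ i → not (i ∈ₛ U) ∨ (i ∈ₛ T))

nonemptyₛ : ∀ {n} → Subset n → Bool
nonemptyₛ U = anyB (λ i → i ∈ₛ U)

-- The adjacency matrix of G[S] is the principal submatrix A[S,S]; its rows
-- are the rows i ∈ S of A restricted to the columns j ∈ S.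

module _ {n : ℕ} (G : Graph n) (S : Subset n) where

  rowSum : Subset n → Fin n → Bool
  rowSum U j = foldr (λ i acc → (if i ∈ₛ U then adj G i j else false) xor acc) false (allFin n)

  rowSumZero : Subset n → Bool
  rowSumZero U = allB (λ j → not (j ∈ₛ S) ∨ not (rowSum U j))

  independent : Subset n → Bool
  independent T =
    all (λ U → not (U ⊆ₛ T ∧ nonemptyₛ U) ∨ not (rowSumZero U)) (allSubsets n)

  rankInduced : ℕ
  rankInduced =
    foldr _⊔_ 0 (map ∣_∣ₛ (filter (λ T → Data.Bool._≟_ (T ⊆ₛ S ∧ independent T) true) (allSubsets n)))
    where import Data.Bool

  nullityInduced : ℕ
  nullityInduced = ∣ S ∣ₛ ∸ rankInduced

-- Bivariate polynomials over ℤ, as coefficient functions (i , j) ↦ a_ij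
-- (coefficient of x^i y^j).

Poly₂ : Set
Poly₂ = ℕ → ℕ → ℤ

sumUpTo : ℕ → (ℕ → ℤ) → ℤ
sumUpTo zero    f = f 0
sumUpTo (suc m) f = sumUpTo m f ℤ.+ f (suc m)

_⊕_ : Poly₂ → Poly₂ → Poly₂
(p ⊕ q) i j = p i j ℤ.+ q i j

_⊗_ : Poly₂ → Poly₂ → Poly₂
(p ⊗ q) i j = sumUpTo i (λ a → sumUpTo j (λ b → p a b ℤ.* q (i ∸ a) (j ∸ b)))

isZero : ℕ → Bool
isZero zero    = true
isZero (suc _) = false

-- monomial c x^a y^b
mono : ℤ → ℕ → ℕ → Poly₂
mono c a b i j = if isZero (ℕ._⊓_ 1 (ℕ._+_ (i ∸ a) (a ∸ i))) ∧ isZero (ℕ._⊓_ 1 (ℕ._+_ (j ∸ b) (b ∸ j))) then c else + 0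

zeroP oneP X Y : Poly₂
zeroP = mono (+ 0) 0 0
oneP  = mono (+ 1) 0 0
X     = mono (+ 1) 1 0
Y     = mono (+ 1) 0 1

_^ₚ_ : Poly₂ → ℕ → Poly₂
p ^ₚ zero  = oneP
p ^ₚ suc k = p ⊗ (p ^ₚ k)

X-1 Y-1 : Poly₂
X-1 = X ⊕ mono (ℤ.- + 1) 0 0
Y-1 = Y ⊕ mono (ℤ.- + 1) 0 0

interlace : ∀ {n} → Graph n → Poly₂
interlace {n} G =
  foldr (λ S acc → ((X-1 ^ₚ rankInduced G S) ⊗ (Y-1 ^ₚ nullityInduced G S)) ⊕ acc)
        zeroP (allSubsets n)

coeff : Poly₂ → ℕ → ℕ → ℤ
coeff p i j = p i j

-- Idea: a₁₀ + a₀₁ is the ε-part of the image of q(G) under x, y ↦ ε in ℤ[ε]/(ε²),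
-- i.e. the derivative of q(G; t, t) at t = 0. The summand of S maps to
-- (ε - 1)^(r + k) with r + k = |S|, so the image is Σ_S (ε - 1)^|S| = (1 + (ε - 1))^N = ε^N,
-- which is 0 as soon as N ≥ 2.

module Submission where

open import Defs
open import Data.Nat using (ℕ; _≤_)
open import Data.Integer using (-_)
open import Relation.Binary.PropositionalEquality using (_≡_)

open import Data.Bool using (true; false; _∧_; _∨_; not; T)
import Data.Bool as Bool
open import Data.Bool.Properties using (T-∧; T-≡)
open import Data.Empty using (⊥-elim)
import Data.Fin as Fin
open import Data.Integer using (ℤ; _+_; _*_; 0ℤ; 1ℤ; -1ℤ)
open import Data.Integer.Properties using (+-0-abelianGroup; *-identityˡ; +-identityˡ; +-identityʳ; +-assoc)
open import Data.Integer.Tactic.RingSolver using (solve-∀)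
open import Data.List using (List; []; _∷_; foldr; concatMap; allFin)
open import Data.List.Membership.Propositional.Properties using (∈-allFin)
import Data.List.Relation.Unary.All as All
open import Data.List.Relation.Unary.All.Properties using (all⁺; all-filter; map⁺)
open import Data.List.Properties using (foldr-preservesᵇ)
open import Data.Nat using (zero; suc; z≤n; s≤s) renaming (_+_ to _+ℕ_)
open import Data.Nat.Properties using (m≤n⇒m≤1+n; ⊔-lub; m+[n∸m]≡n)
open import Data.Product using (_×_; _,_; proj₁; proj₂)
open import Data.Vec using (_∷_; [])
open import Function using (_∘_; Equivalence)
open import Relation.Unary using (Decidable)
open import Relation.Binary.PropositionalEquality using (refl; cong; cong₂; trans; module ≡-Reasoning)
import Relation.Binary.PropositionalEquality as ≡
open import Algebra.Properties.AbelianGroup +-0-abelianGroup using (inverseˡ-unique)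

-- The dual numbers ℤ[ε]/(ε²), with a + b ε written (a , b).

Dual : Set
Dual = ℤ × ℤ

_·_ : Dual → Dual → Dual
(a , b) · (c , d) = a * c , a * d + b * c

infixl 7 _·_

1ᴰ : Dual
1ᴰ = 1ℤ , 0ℤ

_^ᴰ_ : Dual → ℕ → Dual
x ^ᴰ zero  = 1ᴰ
x ^ᴰ suc k = x · (x ^ᴰ k)

·-identityˡ : ∀ x → 1ᴰ · x ≡ x
·-identityˡ (a , b) = cong₂ _,_ (*-identityˡ a) (trans (cong (_+ 0ℤ * a) (*-identityˡ b)) (+-identityʳ b))

·-assoc : ∀ x y z → (x · y) · z ≡ x · (y · z)
·-assoc (a , b) (c , d) (e , f) = cong₂ _,_ (value a c e) (slope a b c d e f)
  where
  value : ∀ a c e → a * c * e ≡ a * (c * e)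
  value = solve-∀
  slope : ∀ a b c d e f →
    a * c * f + (a * d + b * c) * e ≡ a * (c * f + d * e) + b * (c * e)
  slope = solve-∀

^ᴰ-+ : ∀ x m n → x ^ᴰ m · x ^ᴰ n ≡ x ^ᴰ (m +ℕ n)
^ᴰ-+ x zero    n = ·-identityˡ (x ^ᴰ n)
^ᴰ-+ x (suc m) n = trans (·-assoc x (x ^ᴰ m) (x ^ᴰ n)) (cong (x ·_) (^ᴰ-+ x m n))

-- The image of p under ℤ[x, y] → ℤ[ε]/(ε²), x, y ↦ ε.

jet : Poly₂ → Dual
jet p = p 0 0 , p 1 0 + p 0 1

jet-⊗ : ∀ p q → jet (p ⊗ q) ≡ jet p · jet q
jet-⊗ p q = cong (p 0 0 * q 0 0 ,_) (slope (p 0 0) (p 1 0) (p 0 1) (q 0 0) (q 1 0) (q 0 1))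
  where
  slope : ∀ a b c d e f → (a * e + b * d) + (a * f + c * d) ≡ a * (e + f) + (b + c) * d
  slope = solve-∀

jet-^ₚ : ∀ p k → jet (p ^ₚ k) ≡ jet p ^ᴰ k
jet-^ₚ p zero    = refl
jet-^ₚ p (suc k) = trans (jet-⊗ p (p ^ₚ k)) (cong (jet p ·_) (jet-^ₚ p k))

ε-1 : Dual
ε-1 = -1ℤ , 1ℤ

jet-[X-1]^ₚ⊗[Y-1]^ₚ : ∀ r k → jet ((X-1 ^ₚ r) ⊗ (Y-1 ^ₚ k)) ≡ ε-1 ^ᴰ (r +ℕ k)
jet-[X-1]^ₚ⊗[Y-1]^ₚ r k = begin
  jet ((X-1 ^ₚ r) ⊗ (Y-1 ^ₚ k))     ≡⟨ jet-⊗ (X-1 ^ₚ r) (Y-1 ^ₚ k) ⟩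
  jet (X-1 ^ₚ r) · jet (Y-1 ^ₚ k)   ≡⟨ cong₂ _·_ (jet-^ₚ X-1 r) (jet-^ₚ Y-1 k) ⟩
  ε-1 ^ᴰ r · ε-1 ^ᴰ k               ≡⟨ ^ᴰ-+ ε-1 r k ⟩
  ε-1 ^ᴰ (r +ℕ k)                   ∎
  where open ≡-Reasoning

sumOver : {A : Set} → List A → (A → ℤ) → ℤ
sumOver xs f = foldr (λ x acc → f x + acc) 0ℤ xs

sumOver-cong : {A : Set} (xs : List A) {f g : A → ℤ} → (∀ x → f x ≡ g x) → sumOver xs f ≡ sumOver xs g
sumOver-cong []       f≗g = refl
sumOver-cong (x ∷ xs) f≗g = cong₂ _+_ (f≗g x) (sumOver-cong xs f≗g)

sumOver-zero : {A : Set} (xs : List A) → sumOver xs (λ _ → 0ℤ) ≡ 0ℤ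
sumOver-zero []       = refl
sumOver-zero (x ∷ xs) = trans (+-identityˡ _) (sumOver-zero xs)

diagSlope : Poly₂ → ℤ
diagSlope = proj₂ ∘ jet

diagSlope-sum : {A : Set} (f : A → Poly₂) (xs : List A) →
  diagSlope (foldr (λ x acc → f x ⊕ acc) zeroP xs) ≡ sumOver xs (diagSlope ∘ f)
diagSlope-sum f []       = refl
diagSlope-sum f (x ∷ xs) =
  trans (regroup (f x 1 0) (f x 0 1) _ _) (cong (diagSlope (f x) +_) (diagSlope-sum f xs))
  where
  regroup : ∀ a b c d → (a + c) + (b + d) ≡ (a + b) + (c + d)
  regroup = solve-∀

sumOver-allSubsets-suc : ∀ n (h : ℕ → ℤ) →
  sumOver (allSubsets (suc n)) (h ∘ ∣_∣ₛ) ≡ sumOver (allSubsets n) (λ S → h ∣ S ∣ₛ + h (suc ∣ S ∣ₛ))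
sumOver-allSubsets-suc n h = go (allSubsets n)
  where
  go : ∀ xs → sumOver (concatMap (λ S → (false ∷ S) ∷ (true ∷ S) ∷ []) xs) (h ∘ ∣_∣ₛ)
            ≡ sumOver xs (λ S → h ∣ S ∣ₛ + h (suc ∣ S ∣ₛ))
  go []       = refl
  go (S ∷ xs) = trans (≡.sym (+-assoc (h ∣ S ∣ₛ) (h (suc ∣ S ∣ₛ)) _))
                      (cong ((h ∣ S ∣ₛ + h (suc ∣ S ∣ₛ)) +_) (go xs))

-- Both say x + (ε - 1) x = ε x.

proj₁-x+[ε-1]·x≡0 : ∀ x → proj₁ x + proj₁ (ε-1 · x) ≡ 0ℤ
proj₁-x+[ε-1]·x≡0 (a , b) = ringIdentity a
  where
  ringIdentity : ∀ a → a + -1ℤ * a ≡ 0ℤ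
  ringIdentity = solve-∀

proj₂-x+[ε-1]·x≡proj₁-x : ∀ x → proj₂ x + proj₂ (ε-1 · x) ≡ proj₁ x
proj₂-x+[ε-1]·x≡proj₁-x (a , b) = ringIdentity a b
  where
  ringIdentity : ∀ a b → b + (-1ℤ * b + 1ℤ * a) ≡ a
  ringIdentity = solve-∀

sumOver-allSubsets-proj₂-ε-1^ᴰ≡0 : ∀ n → sumOver (allSubsets (suc (suc n))) (proj₂ ∘ (ε-1 ^ᴰ_) ∘ ∣_∣ₛ) ≡ 0ℤ
sumOver-allSubsets-proj₂-ε-1^ᴰ≡0 n = begin
  sumOver (allSubsets (suc (suc n))) (slope ∘ ∣_∣ₛ)
    ≡⟨ sumOver-allSubsets-suc (suc n) slope ⟩
  sumOver (allSubsets (suc n)) (λ S → slope ∣ S ∣ₛ + slope (suc ∣ S ∣ₛ))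
    ≡⟨ sumOver-cong (allSubsets (suc n)) (proj₂-x+[ε-1]·x≡proj₁-x ∘ (ε-1 ^ᴰ_) ∘ ∣_∣ₛ) ⟩
  sumOver (allSubsets (suc n)) (value ∘ ∣_∣ₛ)
    ≡⟨ sumOver-allSubsets-suc n value ⟩
  sumOver (allSubsets n) (λ S → value ∣ S ∣ₛ + value (suc ∣ S ∣ₛ))
    ≡⟨ sumOver-cong (allSubsets n) (proj₁-x+[ε-1]·x≡0 ∘ (ε-1 ^ᴰ_) ∘ ∣_∣ₛ) ⟩
  sumOver (allSubsets n) (λ _ → 0ℤ)
    ≡⟨ sumOver-zero (allSubsets n) ⟩
  0ℤ ∎
  where
  open ≡-Reasoning
  value slope : ℕ → ℤ
  value = proj₁ ∘ (ε-1 ^ᴰ_)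
  slope = proj₂ ∘ (ε-1 ^ᴰ_)

∣∣ₛ-mono : ∀ {n} (U S : Subset n) → (∀ i → T (not (i ∈ₛ U) ∨ (i ∈ₛ S))) → ∣ U ∣ₛ ≤ ∣ S ∣ₛ
∣∣ₛ-mono []          []          U⊆S = z≤n
∣∣ₛ-mono (true ∷ U)  (true ∷ S)  U⊆S = s≤s (∣∣ₛ-mono U S (U⊆S ∘ Fin.suc))
∣∣ₛ-mono (true ∷ U)  (false ∷ S) U⊆S = ⊥-elim (U⊆S Fin.zero)
∣∣ₛ-mono (false ∷ U) (true ∷ S)  U⊆S = m≤n⇒m≤1+n (∣∣ₛ-mono U S (U⊆S ∘ Fin.suc))
∣∣ₛ-mono (false ∷ U) (false ∷ S) U⊆S = ∣∣ₛ-mono U S (U⊆S ∘ Fin.suc)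

⊆ₛ⇒∣∣ₛ≤ : ∀ {n} (U S : Subset n) → T (U ⊆ₛ S) → ∣ U ∣ₛ ≤ ∣ S ∣ₛ
⊆ₛ⇒∣∣ₛ≤ {n} U S U⊆S =
  ∣∣ₛ-mono U S (All.lookup (all⁺ (λ i → not (i ∈ₛ U) ∨ (i ∈ₛ S)) (allFin n) U⊆S) ∘ ∈-allFin)

rankInduced≤∣∣ₛ : ∀ {n} (G : Graph n) (S : Subset n) → rankInduced G S ≤ ∣ S ∣ₛ
rankInduced≤∣∣ₛ {n} G S =
  foldr-preservesᵇ {P = _≤ ∣ S ∣ₛ} ⊔-lub z≤n
    (map⁺ (All.map (λ {U} → bounded U) (all-filter isIndependentSubset? (allSubsets n))))
  where
  isIndependentSubset? : Decidable (λ U → (U ⊆ₛ S ∧ independent G S U) ≡ true)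
  isIndependentSubset? U = U ⊆ₛ S ∧ independent G S U Bool.≟ true
  bounded : ∀ U → (U ⊆ₛ S ∧ independent G S U) ≡ true → ∣ U ∣ₛ ≤ ∣ S ∣ₛ
  bounded U independentSubset =
    ⊆ₛ⇒∣∣ₛ≤ U S (proj₁ (Equivalence.to T-∧ (Equivalence.from T-≡ independentSubset)))

proposition2p3 : (n : ℕ) → 2 ≤ n → (G : Graph n) →
    coeff (interlace G) 1 0 ≡ - coeff (interlace G) 0 1
proposition2p3 (suc (suc n)) (s≤s (s≤s z≤n)) G = inverseˡ-unique _ _ (begin
  diagSlope (interlace G)
    ≡⟨ diagSlope-sum summand (allSubsets (suc (suc n))) ⟩
  sumOver (allSubsets (suc (suc n))) (diagSlope ∘ summand)
    ≡⟨ sumOver-cong (allSubsets (suc (suc n))) diagSlope-summand ⟩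
  sumOver (allSubsets (suc (suc n))) (proj₂ ∘ (ε-1 ^ᴰ_) ∘ ∣_∣ₛ)
    ≡⟨ sumOver-allSubsets-proj₂-ε-1^ᴰ≡0 n ⟩
  0ℤ ∎)
  where
  open ≡-Reasoning
  summand : Subset (suc (suc n)) → Poly₂
  summand S = (X-1 ^ₚ rankInduced G S) ⊗ (Y-1 ^ₚ nullityInduced G S)
  -- nullityInduced G S is the truncated difference ∣ S ∣ₛ ∸ rankInduced G S.
  diagSlope-summand : ∀ S → diagSlope (summand S) ≡ proj₂ (ε-1 ^ᴰ ∣ S ∣ₛ)
  diagSlope-summand S = cong proj₂ (trans (jet-[X-1]^ₚ⊗[Y-1]^ₚ (rankInduced G S) (nullityInduced G S))
                                         (cong (ε-1 ^ᴰ_) (m+[n∸m]≡n (rankInduced≤∣∣ₛ G S))))
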